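{- Let $n\ge1$ and $W\subseteq\{0,\tfrac12,1\}^n$ be any subset. Then $(W,\preceq,\sim,M)$, where $\preceq$, $\sim$ and $M$ are the restrictions to $W$ of $\preceq_n$, $\sim_n$ and $\{0,1\}^n$ respectively, is a subobject of the Kleene space $\widetilde K^n$. Moreover, writing $\iota\colon W\hookrightarrow\{0,\tfrac12,1\}^n$ for the inclusion and $\mathrm{Ker}\,E(\iota)=\{(f,g)\in E(\widetilde K^n)^2: f\circ\iota=g\circ\iota\}$, we have $W=\mathrm{Sol}_{\mathbb K}(\mathrm{Ker}\,E(\iota))$.
   Context: A (finite) Kleene space is a structure $(X,\le,R,M)$ with $(X,\le)$ a finite poset, $M$ a subset of the maximal elements of $X$, $R\subseteq X^2$, such that for all $x,y,z$: $(x,x)\in R$; $(x,y)\in R$ and $x\in M$ imply $y\le x$; $(x,y)\in R$ and $z\le y$ imply $(z,x)\in R$. Morphisms are order-preserving maps that preserve $R$ and map the distinguished subset into the distinguished subset. On $\{0,\tfrac12,1\}$ let $\preceq$ be the order with $\tfrac12\preceq0$, $\tfrac12\preceq1$, $0,1$ incomparable, and let $\sim=\{0,\tfrac12,1\}^2\setminus\{(0,1),(1,0)\}$; $\widetilde K=(\{0,\tfrac12,1\},\preceq,\sim,\{0,1\})$. $\widetilde K^n=(\{0,\tfrac12,1\}^n,\preceq_n,\sim_n,\{0,1\}^n)$ where $\preceq_n,\sim_n$ are defined componentwise. $E(\widetilde K^n)$ is the set of Kleene space morphisms $\widetilde K^n\to\widetilde K$, a Kleene algebra under pointwise operations from the Kleene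 chain $K=\{0,\tfrac12,1\}$ ($0<\tfrac12<1$, $\neg0=1$, $\neg\tfrac12=\tfrac12$). For $\Theta\subseteq E(\widetilde K^n)^2$, $\mathrm{Sol}_{\mathbb K}(\Theta)=\{v\in\{0,\tfrac12,1\}^n: f(v)=g(v)\text{ for all }(f,g)\in\Theta\}$. -}

module Defs where

open import Level using (Level; suc; _⊔_) renaming (zero to lzero)
open import Data.Nat using (ℕ)
open import Data.Bool using (Bool; T)
open import Data.List using (List)
open import Data.List.Membership.Propositional using (_∈_)
open import Data.Vec using (Vec)
open import Data.Vec.Relation.Unary.All using (All)
open import Data.Vec.Relation.Binary.Pointwise.Inductive using (Pointwise)
open import Data.Product using (Σ; ∃; _×_; proj₁)
open import Data.Sum using (_⊎_)
open import Relation.Binary.PropositionalEquality using (_≡_)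

data K : Set where
  k0 kh k1 : K

data _≼_ : K → K → Set where
  ≼-refl : ∀ {a} → a ≼ a
  ≼-half : ∀ {a} → kh ≼ a

-- The relation ∼ = K² \ {(0,1),(1,0)}
data _∼_ : K → K → Set where
  ∼-refl : ∀ {a} → a ∼ a
  ∼-halfˡ : ∀ {a} → kh ∼ a
  ∼-halfʳ : ∀ {a} → a ∼ kh

Bool01 : K → Set
Bool01 a = (a ≡ k0) ⊎ (a ≡ k1)

record KStr : Set₁ where
  field
    Carrier : Set
    _≤_     : Carrier → Carrier → Set
    R       : Carrier → Carrier → Set
    M       : Carrier → Set

record IsKleeneSpace (S : KStr) : Set where
  open KStr S
  field
    finite   : Σ (List Carrier) (λ xs → ∀ x → x ∈ xs)
    ≤-refl   : ∀ x → x ≤ x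
    ≤-antisym : ∀ x y → x ≤ y → y ≤ x → x ≡ y
    ≤-trans  : ∀ x y z → x ≤ y → y ≤ z → x ≤ z
    M-maximal : ∀ x → M x → ∀ y → x ≤ y → y ≡ x
    R-refl   : ∀ x → R x x
    R-M      : ∀ x y → R x y → M x → y ≤ x
    R-down   : ∀ x y z → R x y → z ≤ y → R z x

record IsMorphism (S T : KStr) (f : KStr.Carrier S → KStr.Carrier T) : Set where
  private
    module S = KStr S
    module T = KStr T
  field
    monotone : ∀ x y → x S.≤ y → f x T.≤ f y
    pres-R   : ∀ x y → S.R x y → T.R (f x) (f y)
    pres-M   : ∀ x → S.M x → T.M (f x)

K̃ : KStr
K̃ = record { Carrier = K ; _≤_ = _≼_ ; R = _∼_ ; M = Bool01 }

K̃^ : ℕ → KStr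
K̃^ n = record
  { Carrier = Vec K n
  ; _≤_ = Pointwise _≼_
  ; R = Pointwise _∼_
  ; M = All Bool01
  }

E : ℕ → Set
E n = Σ (Vec K n → K) (IsMorphism (K̃^ n) K̃)

Subset : ℕ → Set
Subset n = Vec K n → Bool

_∈W_ : ∀ {n} → Vec K n → Subset n → Set
v ∈W W = T (W v)

Carrier : ∀ {n} → Subset n → Set
Carrier {n} W = Σ (Vec K n) (λ v → v ∈W W)

Sub : ∀ n → Subset n → KStr
Sub n W = record
  { Carrier = Carrier W
  ; _≤_ = λ x y → Pointwise _≼_ (proj₁ x) (proj₁ y)
  ; R = λ x y → Pointwise _∼_ (proj₁ x) (proj₁ y)
  ; M = λ x → All Bool01 (proj₁ x)
  }

ι : ∀ {n} (W : Subset n) → Carrier W → Vec K n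
ι W = proj₁

IsSubobject : ∀ n (W : Subset n) → Set
IsSubobject n W =
  IsKleeneSpace (Sub n W)
  × IsMorphism (Sub n W) (K̃^ n) (ι W)
  × (∀ x y → ι W x ≡ ι W y → x ≡ y)

InKer : ∀ {n} (W : Subset n) → E n → E n → Set
InKer W f g = ∀ (w : Carrier W) → proj₁ f (ι W w) ≡ proj₁ g (ι W w)

InSol : ∀ {n} → (E n → E n → Set) → Vec K n → Set
InSol {n} Θ v = ∀ (f g : E n) → Θ f g → proj₁ f v ≡ proj₁ g v

-- The restricted structure on W is the substructure of the power K̃ⁿ induced by W, and induced
-- substructures of Kleene spaces are Kleene spaces with a monic inclusion. A point v ∉ W is
-- separated from W by the morphisms literals v ∧ guards v and literals v: at a coordinate where
-- u differs from v, literal vᵢ uᵢ ≤ guard vᵢ uᵢ in the chain order, so the two agree off v,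
-- whereas literals v v = 1 and guards v v ≤ ½. Both are morphisms because morphisms into K̃ are
-- closed under the Kleene operations.
module Submission where

open import Defs
open import Data.Nat using (ℕ; _≤_; zero; suc)
open import Data.Bool using (Bool; true; false; T)
open import Data.Bool.Properties using (T-irrelevant)
open import Data.Unit using (tt)
open import Data.Empty using (⊥-elim)
open import Data.List using (List; []; _∷_; map; concatMap; cartesianProductWith)
open import Data.List.Membership.Propositional using (_∈_; lose)
open import Data.List.Membership.Propositional.Properties
  using (∈-map⁺; ∈-concatMap⁺; ∈-cartesianProductWith⁺)
open import Data.List.Relation.Unary.Any using (here; there)
open import Data.Vec using (Vec; []; _∷_; head; tail)
open import Data.Vec.Relation.Unary.All using (All; []; _∷_)
open import Data.Vec.Relation.Binary.Pointwise.Inductive as Pointwise using (Pointwise; []; _∷_)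
open import Data.Product using (Σ; ∃; ∃₂; _×_; _,_; proj₁; proj₂)
open import Data.Product.Properties using (Σ-≡,≡→≡)
open import Data.Sum using (_⊎_; inj₁; inj₂)
open import Function using (_∘_; id; const)
open import Function.Bundles using (_⇔_; mk⇔)
open import Relation.Binary.Core using (_Preserves₂_⟶_⟶_)
open import Relation.Binary.PropositionalEquality using (_≡_; _≢_; refl; cong; cong₂)
open import Relation.Nullary.Decidable using (T?; decidable-stable)
import Relation.Binary.Reasoning.Base.Single as SingleReasoning

Enumerable : Set → Set
Enumerable A = Σ (List A) (λ xs → ∀ x → x ∈ xs)

T-enumerable : ∀ b → Enumerable (T b)
T-enumerable false = [] , λ ()
T-enumerable true  = tt ∷ [] , λ { tt → here refl }

Σ-enumerable : {A : Set} {B : A → Set} →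
               Enumerable A → (∀ x → Enumerable (B x)) → Enumerable (Σ A B)
Σ-enumerable {B = B} (xs , xs-complete) fibres =
  concatMap fibre xs ,
  λ (x , y) → ∈-concatMap⁺ fibre (lose (xs-complete x) (∈-map⁺ (x ,_) (proj₂ (fibres x) y)))
  where
  fibre : _ → List (Σ _ B)
  fibre x = map (x ,_) (proj₁ (fibres x))

Vec-enumerable : {A : Set} → Enumerable A → ∀ n → Enumerable (Vec A n)
Vec-enumerable _ zero = [] ∷ [] , λ { [] → here refl }
Vec-enumerable (as , as-complete) (suc n) with Vec-enumerable (as , as-complete) n
... | vs , vs-complete =
  cartesianProductWith _∷_ as vs ,
  λ { (a ∷ v) → ∈-cartesianProductWith⁺ _∷_ (as-complete a) (vs-complete v) }

_^_ : KStr → ℕ → KStr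
S ^ n = record
  { Carrier = Vec A n
  ; _≤_     = Pointwise _⊑_
  ; R       = Pointwise R
  ; M       = All M
  }
  where open KStr S renaming (Carrier to A; _≤_ to _⊑_)

induced : (S : KStr) → (KStr.Carrier S → Bool) → KStr
induced S P = record
  { Carrier = Σ A (T ∘ P)
  ; _≤_     = λ x y → proj₁ x ⊑ proj₁ y
  ; R       = λ x y → R (proj₁ x) (proj₁ y)
  ; M       = M ∘ proj₁
  }
  where open KStr S renaming (Carrier to A; _≤_ to _⊑_)

^-isKleeneSpace : ∀ {S} → IsKleeneSpace S → ∀ n → IsKleeneSpace (S ^ n)
^-isKleeneSpace {S} isKS n = record
  { finite    = Vec-enumerable finite n
  ; ≤-refl    = λ _ → Pointwise.refl (≤-refl _)
  ; ≤-antisym = λ _ _ → pointwise-antisym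
  ; ≤-trans   = λ _ _ _ → Pointwise.trans (≤-trans _ _ _)
  ; M-maximal = λ _ → all-maximal
  ; R-refl    = λ _ → Pointwise.refl (R-refl _)
  ; R-M       = λ _ _ → pointwise-R-M
  ; R-down    = λ _ _ _ → pointwise-R-down
  }
  where
  open KStr S renaming (Carrier to A; _≤_ to _⊑_)
  open IsKleeneSpace isKS

  pointwise-antisym : ∀ {m} {x y : Vec A m} →
                      Pointwise _⊑_ x y → Pointwise _⊑_ y x → x ≡ y
  pointwise-antisym []       []       = refl
  pointwise-antisym (p ∷ ps) (q ∷ qs) = cong₂ _∷_ (≤-antisym _ _ p q) (pointwise-antisym ps qs)

  all-maximal : ∀ {m} {x : Vec A m} → All M x → ∀ y → Pointwise _⊑_ x y → y ≡ x
  all-maximal []       []      []       = refl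
  all-maximal (m ∷ ms) (_ ∷ y) (p ∷ ps) = cong₂ _∷_ (M-maximal _ m _ p) (all-maximal ms y ps)

  pointwise-R-M : ∀ {m} {x y : Vec A m} → Pointwise R x y → All M x → Pointwise _⊑_ y x
  pointwise-R-M []       []       = []
  pointwise-R-M (r ∷ rs) (m ∷ ms) = R-M _ _ r m ∷ pointwise-R-M rs ms

  pointwise-R-down : ∀ {m} {x y z : Vec A m} →
                     Pointwise R x y → Pointwise _⊑_ z y → Pointwise R z x
  pointwise-R-down []       []       = []
  pointwise-R-down (r ∷ rs) (p ∷ ps) = R-down _ _ _ r p ∷ pointwise-R-down rs ps

module _ {S : KStr} (P : KStr.Carrier S → Bool) where
  open KStr S using () renaming (Carrier to A)

  proj₁-injective : ∀ (x y : Σ A (T ∘ P)) → proj₁ x ≡ proj₁ y → x ≡ y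
  proj₁-injective _ _ refl = Σ-≡,≡→≡ (refl , T-irrelevant _ _)

  proj₁-isMorphism : IsMorphism (induced S P) S proj₁
  proj₁-isMorphism = record { monotone = λ _ _ → id ; pres-R = λ _ _ → id ; pres-M = λ _ → id }

  induced-isKleeneSpace : IsKleeneSpace S → IsKleeneSpace (induced S P)
  induced-isKleeneSpace isKS = record
    { finite    = Σ-enumerable finite (T-enumerable ∘ P)
    ; ≤-refl    = λ x → ≤-refl (proj₁ x)
    ; ≤-antisym = λ x y p q → proj₁-injective x y (≤-antisym _ _ p q)
    ; ≤-trans   = λ _ _ _ → ≤-trans _ _ _
    ; M-maximal = λ x m y p → proj₁-injective y x (M-maximal _ m _ p)
    ; R-refl    = λ x → R-refl (proj₁ x)
    ; R-M       = λ _ _ → R-M _ _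
    ; R-down    = λ _ _ _ → R-down _ _ _
    }
    where open IsKleeneSpace isKS

≼-antisym : ∀ {a b} → a ≼ b → b ≼ a → a ≡ b
≼-antisym ≼-refl _      = refl
≼-antisym ≼-half ≼-refl = refl
≼-antisym ≼-half ≼-half = refl

≼-trans : ∀ {a b c} → a ≼ b → b ≼ c → a ≼ c
≼-trans ≼-refl q = q
≼-trans ≼-half _ = ≼-half

Bool01-maximal : ∀ {a b} → Bool01 a → a ≼ b → b ≡ a
Bool01-maximal _          ≼-refl = refl
Bool01-maximal (inj₁ ()) ≼-half
Bool01-maximal (inj₂ ()) ≼-half

∼-sym : ∀ {a b} → a ∼ b → b ∼ a
∼-sym ∼-refl  = ∼-refl
∼-sym ∼-halfˡ = ∼-halfʳ
∼-sym ∼-halfʳ = ∼-halfˡ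

∼-Bool01 : ∀ {a b} → a ∼ b → Bool01 a → b ≼ a
∼-Bool01 ∼-refl  _         = ≼-refl
∼-Bool01 ∼-halfˡ (inj₁ ())
∼-Bool01 ∼-halfˡ (inj₂ ())
∼-Bool01 ∼-halfʳ _         = ≼-half

∼-down : ∀ {a b c} → a ∼ b → c ≼ b → c ∼ a
∼-down r ≼-refl = ∼-sym r
∼-down _ ≼-half = ∼-halfˡ

K̃-isKleeneSpace : IsKleeneSpace K̃
K̃-isKleeneSpace = record
  { finite    = k0 ∷ kh ∷ k1 ∷ [] ,
                λ { k0 → here refl ; kh → there (here refl) ; k1 → there (there (here refl)) }
  ; ≤-refl    = λ _ → ≼-refl
  ; ≤-antisym = λ _ _ → ≼-antisym
  ; ≤-trans   = λ _ _ _ → ≼-trans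
  ; M-maximal = λ _ m _ → Bool01-maximal m
  ; R-refl    = λ _ → ∼-refl
  ; R-M       = λ _ _ → ∼-Bool01
  ; R-down    = λ _ _ _ → ∼-down
  }

isSubobject : ∀ n (W : Subset n) → IsSubobject n W
isSubobject n W =
  induced-isKleeneSpace W (^-isKleeneSpace K̃-isKleeneSpace n) ,
  proj₁-isMorphism {K̃^ n} W ,
  proj₁-injective {K̃^ n} W

∘-isMorphism : ∀ {S T U} {f : KStr.Carrier S → KStr.Carrier T} {g : KStr.Carrier T → KStr.Carrier U} →
               IsMorphism S T f → IsMorphism T U g → IsMorphism S U (g ∘ f)
∘-isMorphism f-mor g-mor = record
  { monotone = λ x y → g.monotone _ _ ∘ f.monotone x y
  ; pres-R   = λ x y → g.pres-R _ _ ∘ f.pres-R x y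
  ; pres-M   = λ x → g.pres-M _ ∘ f.pres-M x
  }
  where
  module f = IsMorphism f-mor
  module g = IsMorphism g-mor

id-isMorphism : ∀ {S} → IsMorphism S S id
id-isMorphism = record { monotone = λ _ _ → id ; pres-R = λ _ _ → id ; pres-M = λ _ → id }

const-isMorphism : ∀ {S c} → Bool01 c → IsMorphism S K̃ (const c)
const-isMorphism c∈M = record
  { monotone = λ _ _ _ → ≼-refl ; pres-R = λ _ _ _ → ∼-refl ; pres-M = λ _ _ → c∈M }

head-isMorphism : ∀ {S n} → IsMorphism (S ^ suc n) S head
head-isMorphism = record
  { monotone = λ { _ _ (p ∷ _) → p } ; pres-R = λ { _ _ (r ∷ _) → r } ; pres-M = λ { _ (m ∷ _) → m } }

tail-isMorphism : ∀ {S n} → IsMorphism (S ^ suc n) (S ^ n) tail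
tail-isMorphism = record
  { monotone = λ { _ _ (_ ∷ ps) → ps } ; pres-R = λ { _ _ (_ ∷ rs) → rs } ; pres-M = λ { _ (_ ∷ ms) → ms } }

¬_ : K → K
¬ k0 = k1
¬ kh = kh
¬ k1 = k0

-- Tighter than _≼_ and _∼_, which Defs leaves at the default fixity 20.
infix  23 ¬_
infixr 22 _∧_
infixr 21 _∨_

_∧_ : K → K → K
k0 ∧ _  = k0
kh ∧ k0 = k0
kh ∧ _  = kh
k1 ∧ y  = y

_∨_ : K → K → K
x ∨ y = ¬ (¬ x ∧ ¬ y)

¬-isMorphism : IsMorphism K̃ K̃ ¬_
¬-isMorphism = record { monotone = λ _ _ → ¬-mono ; pres-R = λ _ _ → ¬-pres-∼ ; pres-M = λ _ → ¬-crisp }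
  where
  ¬-mono : ∀ {a b} → a ≼ b → ¬ a ≼ ¬ b
  ¬-mono ≼-refl = ≼-refl
  ¬-mono ≼-half = ≼-half

  ¬-pres-∼ : ∀ {a b} → a ∼ b → ¬ a ∼ ¬ b
  ¬-pres-∼ ∼-refl  = ∼-refl
  ¬-pres-∼ ∼-halfˡ = ∼-halfˡ
  ¬-pres-∼ ∼-halfʳ = ∼-halfʳ

  ¬-crisp : ∀ {a} → Bool01 a → Bool01 (¬ a)
  ¬-crisp (inj₁ refl) = inj₂ refl
  ¬-crisp (inj₂ refl) = inj₁ refl

∧-mono-≼ : _∧_ Preserves₂ _≼_ ⟶ _≼_ ⟶ _≼_
∧-mono-≼ ≼-refl ≼-refl = ≼-refl
∧-mono-≼ {k0} ≼-refl ≼-half = ≼-refl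
∧-mono-≼ {kh} ≼-refl ≼-half = ≼-half
∧-mono-≼ {k1} ≼-refl ≼-half = ≼-half
∧-mono-≼ {_} {k0} ≼-half (≼-refl {k0}) = ≼-refl
∧-mono-≼ {_} {kh} ≼-half (≼-refl {k0}) = ≼-refl
∧-mono-≼ {_} {k1} ≼-half (≼-refl {k0}) = ≼-refl
∧-mono-≼ ≼-half (≼-refl {kh}) = ≼-half
∧-mono-≼ ≼-half (≼-refl {k1}) = ≼-half
∧-mono-≼ ≼-half ≼-half = ≼-half

∧-crisp : ∀ {a b} → Bool01 a → Bool01 b → Bool01 (a ∧ b)
∧-crisp (inj₁ refl) _ = inj₁ refl
∧-crisp (inj₂ refl) q = q

-- ∼ is compatibility, i.e. having a common ≼-upper bound; so ≼-monotone operations preserve it.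
∼⇒upperBound : ∀ {a b} → a ∼ b → ∃ λ c → a ≼ c × b ≼ c
∼⇒upperBound (∼-refl {a})  = a , ≼-refl , ≼-refl
∼⇒upperBound (∼-halfˡ {a}) = a , ≼-half , ≼-refl
∼⇒upperBound (∼-halfʳ {a}) = a , ≼-refl , ≼-half

upperBound⇒∼ : ∀ {a b c} → a ≼ c → b ≼ c → a ∼ b
upperBound⇒∼ ≼-refl ≼-refl = ∼-refl
upperBound⇒∼ ≼-refl ≼-half = ∼-halfʳ
upperBound⇒∼ ≼-half _      = ∼-halfˡ

∧-pres-∼ : _∧_ Preserves₂ _∼_ ⟶ _∼_ ⟶ _∼_
∧-pres-∼ r s with ∼⇒upperBound r | ∼⇒upperBound s
... | _ , p , q | _ , p′ , q′ = upperBound⇒∼ (∧-mono-≼ p p′) (∧-mono-≼ q q′)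

∧-isMorphism : ∀ {S} {f g : KStr.Carrier S → K} →
               IsMorphism S K̃ f → IsMorphism S K̃ g → IsMorphism S K̃ (λ x → f x ∧ g x)
∧-isMorphism f-mor g-mor = record
  { monotone = λ x y p → ∧-mono-≼ (f.monotone x y p) (g.monotone x y p)
  ; pres-R   = λ x y r → ∧-pres-∼ (f.pres-R x y r) (g.pres-R x y r)
  ; pres-M   = λ x m → ∧-crisp (f.pres-M x m) (g.pres-M x m)
  }
  where
  module f = IsMorphism f-mor
  module g = IsMorphism g-mor

∨-isMorphism : ∀ {S} {f g : KStr.Carrier S → K} →
               IsMorphism S K̃ f → IsMorphism S K̃ g → IsMorphism S K̃ (λ x → f x ∨ g x)
∨-isMorphism f-mor g-mor =
  ∘-isMorphism (∧-isMorphism (∘-isMorphism f-mor ¬-isMorphism) (∘-isMorphism g-mor ¬-isMorphism))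
               ¬-isMorphism

infix 4 _≤ᴷ_

data _≤ᴷ_ : K → K → Set where
  0≤  : ∀ {x} → k0 ≤ᴷ x
  ½≤½ : kh ≤ᴷ kh
  ≤1  : ∀ {x} → x ≤ᴷ k1

≤ᴷ-refl : ∀ {x} → x ≤ᴷ x
≤ᴷ-refl {k0} = 0≤
≤ᴷ-refl {kh} = ½≤½
≤ᴷ-refl {k1} = ≤1

≤ᴷ-trans : ∀ {x y z} → x ≤ᴷ y → y ≤ᴷ z → x ≤ᴷ z
≤ᴷ-trans 0≤  _ = 0≤
≤ᴷ-trans ½≤½ q = q
≤ᴷ-trans ≤1 ≤1 = ≤1

module ≤ᴷ-Reasoning = SingleReasoning _≤ᴷ_ ≤ᴷ-refl ≤ᴷ-trans

x∧y≤x : ∀ x y → x ∧ y ≤ᴷ x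
x∧y≤x k0 _  = 0≤
x∧y≤x kh k0 = 0≤
x∧y≤x kh kh = ½≤½
x∧y≤x kh k1 = ½≤½
x∧y≤x k1 _  = ≤1

x∧y≤y : ∀ x y → x ∧ y ≤ᴷ y
x∧y≤y k0 _  = 0≤
x∧y≤y kh k0 = 0≤
x∧y≤y kh kh = ½≤½
x∧y≤y kh k1 = ≤1
x∧y≤y k1 _  = ≤ᴷ-refl

x≤x∨y : ∀ x y → x ≤ᴷ x ∨ y
x≤x∨y k0 _  = 0≤
x≤x∨y kh k0 = ½≤½
x≤x∨y kh kh = ½≤½
x≤x∨y kh k1 = ≤1
x≤x∨y k1 _  = ≤1

y≤x∨y : ∀ x y → y ≤ᴷ x ∨ y
y≤x∨y _  k0 = 0≤
y≤x∨y k0 kh = ½≤½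
y≤x∨y kh kh = ½≤½
y≤x∨y k1 kh = ≤1
y≤x∨y k0 k1 = ≤1
y≤x∨y kh k1 = ≤1
y≤x∨y k1 k1 = ≤1

∨-lub : ∀ {x y z} → x ≤ᴷ z → y ≤ᴷ z → x ∨ y ≤ᴷ z
∨-lub ≤1  _   = ≤1
∨-lub _   ≤1  = ≤1
∨-lub 0≤  0≤  = 0≤
∨-lub 0≤  ½≤½ = ½≤½
∨-lub ½≤½ 0≤  = ½≤½
∨-lub ½≤½ ½≤½ = ½≤½

x≤y⇒x∧y≡x : ∀ {x y} → x ≤ᴷ y → x ∧ y ≡ x
x≤y⇒x∧y≡x 0≤        = refl
x≤y⇒x∧y≡x ½≤½       = refl
x≤y⇒x∧y≡x (≤1 {k0}) = refl
x≤y⇒x∧y≡x (≤1 {kh}) = refl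
x≤y⇒x∧y≡x (≤1 {k1}) = refl

x≤½⇒x≢1 : ∀ {x} → x ≤ᴷ kh → x ≢ k1
x≤½⇒x≢1 0≤  ()
x≤½⇒x≢1 ½≤½ ()

literal : K → K → K
literal k0 x = ¬ x
literal kh _ = k1
literal k1 x = x

guard : K → K → K
guard k0 x = x ∧ ¬ x
guard kh x = x ∨ ¬ x
guard k1 x = x ∧ ¬ x

literal-isMorphism : ∀ a → IsMorphism K̃ K̃ (literal a)
literal-isMorphism k0 = ¬-isMorphism
literal-isMorphism kh = const-isMorphism (inj₂ refl)
literal-isMorphism k1 = id-isMorphism

guard-isMorphism : ∀ a → IsMorphism K̃ K̃ (guard a)
guard-isMorphism k0 = ∧-isMorphism id-isMorphism ¬-isMorphism
guard-isMorphism kh = ∨-isMorphism id-isMorphism ¬-isMorphism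
guard-isMorphism k1 = ∧-isMorphism id-isMorphism ¬-isMorphism

literal-refl : ∀ a → literal a a ≡ k1
literal-refl k0 = refl
literal-refl kh = refl
literal-refl k1 = refl

guard-refl : ∀ a → guard a a ≤ᴷ kh
guard-refl k0 = 0≤
guard-refl kh = ½≤½
guard-refl k1 = 0≤

≡⊎literal≤guard : ∀ a b → a ≡ b ⊎ literal a b ≤ᴷ guard a b
≡⊎literal≤guard k0 k0 = inj₁ refl
≡⊎literal≤guard k0 kh = inj₂ ½≤½
≡⊎literal≤guard k0 k1 = inj₂ 0≤
≡⊎literal≤guard kh k0 = inj₂ ≤1
≡⊎literal≤guard kh kh = inj₁ refl
≡⊎literal≤guard kh k1 = inj₂ ≤1
≡⊎literal≤guard k1 k0 = inj₂ 0≤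
≡⊎literal≤guard k1 kh = inj₂ ½≤½
≡⊎literal≤guard k1 k1 = inj₁ refl

literals : ∀ {n} → Vec K n → Vec K n → K
literals []      _ = k1
literals (a ∷ v) u = literal a (head u) ∧ literals v (tail u)

guards : ∀ {n} → Vec K n → Vec K n → K
guards []      _ = k0
guards (a ∷ v) u = guard a (head u) ∨ guards v (tail u)

literals-isMorphism : ∀ {n} (v : Vec K n) → IsMorphism (K̃^ n) K̃ (literals v)
literals-isMorphism []      = const-isMorphism (inj₂ refl)
literals-isMorphism (a ∷ v) =
  ∧-isMorphism (∘-isMorphism head-isMorphism (literal-isMorphism a))
               (∘-isMorphism tail-isMorphism (literals-isMorphism v))

guards-isMorphism : ∀ {n} (v : Vec K n) → IsMorphism (K̃^ n) K̃ (guards v)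
guards-isMorphism []      = const-isMorphism (inj₁ refl)
guards-isMorphism (a ∷ v) =
  ∨-isMorphism (∘-isMorphism head-isMorphism (guard-isMorphism a))
               (∘-isMorphism tail-isMorphism (guards-isMorphism v))

literals-refl : ∀ {n} (v : Vec K n) → literals v v ≡ k1
literals-refl []      = refl
literals-refl (a ∷ v) = cong₂ _∧_ (literal-refl a) (literals-refl v)

guards-refl : ∀ {n} (v : Vec K n) → guards v v ≤ᴷ kh
guards-refl []      = 0≤
guards-refl (a ∷ v) = ∨-lub (guard-refl a) (guards-refl v)

literals≤guards : ∀ {n} (v u : Vec K n) → u ≢ v → literals v u ≤ᴷ guards v u
literals≤guards []      []      u≢v = ⊥-elim (u≢v refl)
literals≤guards (a ∷ v) (b ∷ u) u≢v with ≡⊎literal≤guard a b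
... | inj₂ literal≤guard = begin
  literal a b ∧ literals v u  ∼⟨ x∧y≤x _ _ ⟩
  literal a b                 ∼⟨ literal≤guard ⟩
  guard a b                   ∼⟨ x≤x∨y _ _ ⟩
  guard a b ∨ guards v u      ∎
  where open ≤ᴷ-Reasoning
... | inj₁ refl = begin
  literal a a ∧ literals v u  ∼⟨ x∧y≤y _ _ ⟩
  literals v u                ∼⟨ literals≤guards v u (u≢v ∘ cong (a ∷_)) ⟩
  guards v u                  ∼⟨ y≤x∨y _ _ ⟩
  guard a a ∨ guards v u      ∎
  where open ≤ᴷ-Reasoning

separating-pair : ∀ {n} (v : Vec K n) →
                  ∃₂ λ (f g : E n) → (∀ u → u ≢ v → proj₁ f u ≡ proj₁ g u) × proj₁ f v ≢ proj₁ g v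
separating-pair v =
  (_ , ∧-isMorphism (literals-isMorphism v) (guards-isMorphism v)) ,
  (_ , literals-isMorphism v) ,
  (λ u u≢v → x≤y⇒x∧y≡x (literals≤guards v u u≢v)) ,
  differ
  where
  differ : literals v v ∧ guards v v ≢ literals v v
  differ rewrite literals-refl v = x≤½⇒x≢1 (guards-refl v)

Sol-Ker⊆W : ∀ {n} (W : Subset n) (v : Vec K n) → InSol (InKer W) v → v ∈W W
Sol-Ker⊆W W v v∈Sol = decidable-stable (T? (W v)) λ v∉W →
  let f , g , agree-off-v , differ-at-v = separating-pair v
  in differ-at-v (v∈Sol f g λ (u , u∈W) → agree-off-v u λ { refl → v∉W u∈W })

lemma2p3 : (n : ℕ) → 1 ≤ n → (W : Subset n) →
    IsSubobject n W × (∀ (v : Vec K n) → (v ∈W W) ⇔ InSol (InKer W) v)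
lemma2p3 n _ W =
  isSubobject n W ,
  λ v → mk⇔ (λ v∈W f g f≡g-on-W → f≡g-on-W (v , v∈W)) (Sol-Ker⊆W W v)
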